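{- Let $G$ be a graph on $n$ vertices with minimum degree $\delta(G)=\delta$ and let $q$ and $\gamma\leqslant\left\lfloor\frac{\delta}{2(q+1)}\right\rfloor$ be positive integers. When playing a $(1:q)$ Waiter-Client game on $E(G)$, Waiter has a strategy to force Client to build a spanning subgraph of $G$ with minimum degree at least $\gamma$, by offering at most $(q+1)\gamma n$ edges of $G$.
   Context: In a $(1:q)$ Waiter-Client game on a board $X$, in each round Waiter offers Client $q+1$ previously unclaimed elements of $X$ (or all remaining ones if fewer than $q+1$ remain, in which case Waiter claims them all); Client claims one offered element and Waiter claims the others. Client's graph is the spanning subgraph of $G$ formed by the edges Client has claimed. -}

module Defs where

open import Data.Nat using (ℕ; zero; suc; _+_; _*_; _∸_; _≤_; _<_; _<ᵇ_)
open import Data.Bool using (Bool; true; false; _∧_; _∨_; not)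
open import Data.Fin using (Fin; toℕ; _≟_)
open import Data.Product using (_×_; _,_; proj₁; proj₂)
open import Data.List using (List; length; filterᵇ; allFin; cartesianProduct)
open import Data.Bool.ListAction using (any)
open import Data.List.Relation.Unary.All using (All)
open import Data.List.Relation.Unary.Unique.Propositional using (Unique)
open import Data.List.Membership.Propositional using (_∈_)
open import Relation.Binary.PropositionalEquality using (_≡_)
open import Relation.Nullary.Decidable using (⌊_⌋)

Mat : ℕ → Set
Mat n = Fin n → Fin n → Bool

record Graph (n : ℕ) : Set where
  field
    adj    : Mat n
    sym    : ∀ i j → adj i j ≡ adj j i
    irrefl : ∀ i → adj i i ≡ false
open Graph public

deg : ∀ {n} → Mat n → Fin n → ℕ
deg {n} A v = length (filterᵇ (A v) (allFin n))

edgeCount : ∀ {n} → Mat n → ℕ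
edgeCount {n} A =
  length (filterᵇ (λ p → (toℕ (proj₁ p) <ᵇ toℕ (proj₂ p)) ∧ A (proj₁ p) (proj₂ p))
                  (cartesianProduct (allFin n) (allFin n)))

MinDegAtLeast : ∀ {n} → Mat n → ℕ → Set
MinDegAtLeast A γ = ∀ v → γ ≤ deg A v

IsMinDegree : ∀ {n} → Graph n → ℕ → Set
IsMinDegree {n} G δ = (∀ v → δ ≤ deg (adj G) v) × Data.Product.∃ (λ v → deg (adj G) v ≡ δ)

-- an edge, written (a , b) with a < b, is the unordered pair {a,b}
Edge : ℕ → Set
Edge n = Fin n × Fin n

hits : ∀ {n} → Edge n → Fin n → Fin n → Bool
hits (a , b) x y = (⌊ a ≟ x ⌋ ∧ ⌊ b ≟ y ⌋) ∨ (⌊ a ≟ y ⌋ ∧ ⌊ b ≟ x ⌋)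

removeAll : ∀ {n} → List (Edge n) → Mat n → Mat n
removeAll O U x y = U x y ∧ not (any (λ e → hits e x y) O)

addEdge : ∀ {n} → Edge n → Mat n → Mat n
addEdge e C x y = C x y ∨ hits e x y

emptyMat : ∀ {n} → Mat n
emptyMat _ _ = false

ValidOffer : ∀ {n} → ℕ → Mat n → List (Edge n) → Set
ValidOffer q U O =
  (length O ≡ suc q) × Unique O ×
  All (λ e → (toℕ (proj₁ e) < toℕ (proj₂ e)) × (U (proj₁ e) (proj₂ e) ≡ true)) O

-- WaiterForces q P U C b : in a (1:q) Waiter-Client game where U is the set of
-- currently unclaimed board edges and C is Client's current graph, Waiter has a
-- strategy ensuring that Client's graph satisfies P at some point, while
-- offering at most b further edges in total.
data WaiterForces {n : ℕ} (q : ℕ) (P : Mat n → Set) : Mat n → Mat n → ℕ → Set where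
  done  : ∀ {U C b} → P C → WaiterForces q P U C b
  round : ∀ {U C b} (O : List (Edge n)) → ValidOffer q U O → suc q ≤ b →
          (∀ e → e ∈ O → WaiterForces q P (removeAll O U) (addEdge e C) (b ∸ suc q)) →
          WaiterForces q P U C b
  -- final round: fewer than q+1 edges remain; all are offered and Waiter claims them all
  final : ∀ {U C b} → 0 < edgeCount U → edgeCount U < suc q → edgeCount U ≤ b →
          WaiterForces q P emptyMat C (b ∸ edgeCount U) →
          WaiterForces q P U C b

module Submission where

-- Orient the edges of G so that in- and out-degree differ by at most one at every vertex; then
-- every vertex v has at least ⌊deg v / 2⌋ ≥ (q+1)γ out-neighbours.  Such an orientation exists
-- by induction on the number of edges: a loop is harmless; an edge ab followed elsewhere by an
-- edge bc is replaced by the single edge ac, and an orientation of ac is routed back through b;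
-- if b has no other edge, ab is oriented so as to raise the smaller of the in- and out-degree of a.
-- Waiter then serves the vertices one at a time: γ times she offers q+1 unclaimed out-edges of
-- v, and each time Client's degree at v grows.  Out-edges of distinct vertices are distinct
-- edges, so the out-edges of vertices served later are still unclaimed when their turn comes,
-- and at most (q+1)γ edges are offered per vertex.

open import Defs renaming (sym to adj-sym)

open import Data.Bool using (Bool; true; false; T?; _∧_; _∨_; not; if_then_else_)
open import Data.Bool.ListAction using (any; or)
open import Data.Bool.Properties using (∧-comm; ∧-zeroʳ; ∨-comm; ∨-zeroʳ; T-∧; T-≡; ¬-not)
open import Data.Empty using (⊥-elim)
open import Data.Fin using (Fin; toℕ; _≟_)
open import Data.Fin.Properties using (toℕ-injective)
open import Data.List
  using (List; []; _∷_; [_]; _++_; length; map; filterᵇ; cartesianProduct; allFin; take; drop)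
open import Data.List.Membership.Propositional using (_∈_; _∉_; find)
open import Data.List.Membership.Propositional.Properties
  using (∈-∃++; ∈-filter⁻; ∈-allFin; ∈-map⁻; ∈-++⁺ˡ; ∈-++⁺ʳ)
open import Data.List.Properties
  using ( filter-++; ++-identityʳ; length-map; map-cong; length-take; length-drop; length-tabulate
        ; take++drop≡id)
open import Data.List.Relation.Binary.Pointwise using (Pointwise; []; _∷_; ++⁺)
open import Data.List.Relation.Unary.All as All using (All; []; _∷_)
open import Data.List.Relation.Unary.All.Properties using (¬Any⇒All¬)
open import Data.List.Relation.Unary.AllPairs using (AllPairs; []; _∷_)
open import Data.List.Relation.Unary.Any using (here; there; any?)
open import Data.List.Relation.Unary.Unique.Propositional using (Unique)
import Data.List.Relation.Unary.Unique.Propositional.Properties as Unique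
open import Data.Nat using (ℕ; zero; suc; _+_; _*_; _∸_; _/_; _≤_; _<_; _<ᵇ_; z≤n; s≤s; s≤s⁻¹)
open import Data.Nat.DivMod using (m/n*n≤m)
open import Data.Nat.Properties hiding (_≟_)
open import Algebra.Properties.CommutativeSemigroup +-commutativeSemigroup
  using (interchange; x∙yz≈y∙xz)
open import Data.Product using (_×_; _,_; proj₁; proj₂; swap; ∃-syntax)
open import Data.Sum using (_⊎_; inj₁; inj₂; [_,_]′; map₂)
open import Function using (_∘_; id; case_of_)
open import Function.Bundles using (Equivalence)
open import Relation.Binary.Definitions using (DecidableEquality)
open import Relation.Binary.PropositionalEquality hiding ([_])
open import Relation.Nullary using (¬_; Dec; yes; no)
open import Relation.Nullary.Decidable using (⌊_⌋; _⊎-dec_)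
open import Relation.Nullary.Reflects using (ofʸ; ofⁿ)

private
  variable
    A B : Set

𝟙 : Bool → ℕ
𝟙 true  = 1
𝟙 false = 0

𝟙-mono-∨ : ∀ b c → 𝟙 b ≤ 𝟙 (b ∨ c)
𝟙-mono-∨ true  c = ≤-refl
𝟙-mono-∨ false c = z≤n

⌊⌋-true : ∀ {P : Set} {P? : Dec P} → P → ⌊ P? ⌋ ≡ true
⌊⌋-true {P? = yes _} p = refl
⌊⌋-true {P? = no ¬p} p = ⊥-elim (¬p p)

⌊⌋-false : ∀ {P : Set} {P? : Dec P} → ¬ P → ⌊ P? ⌋ ≡ false
⌊⌋-false {P? = no _}  ¬p = refl
⌊⌋-false {P? = yes p} ¬p = ⊥-elim (¬p p)

count : (A → Bool) → List A → ℕ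
count p []       = 0
count p (x ∷ xs) = 𝟙 (p x) + count p xs

length-filterᵇ : ∀ (p : A → Bool) xs → length (filterᵇ p xs) ≡ count p xs
length-filterᵇ p []       = refl
length-filterᵇ p (x ∷ xs) with p x
... | true  = cong suc (length-filterᵇ p xs)
... | false = length-filterᵇ p xs

count-insert : ∀ (p : A → Bool) xs y ys → count p (xs ++ y ∷ ys) ≡ 𝟙 (p y) + count p (xs ++ ys)
count-insert p []       y ys = refl
count-insert p (x ∷ xs) y ys =
  trans (cong (𝟙 (p x) +_) (count-insert p xs y ys)) (x∙yz≈y∙xz (𝟙 (p x)) (𝟙 (p y)) _)

count-detour : ∀ (p : A → Bool) k x y z xs ys → 𝟙 (p x) + 𝟙 (p y) ≡ k + 𝟙 (p z) →
               count p (x ∷ xs ++ y ∷ ys) ≡ k + count p (z ∷ xs ++ ys)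
count-detour p k x y z xs ys split = begin
  𝟙 (p x) + count p (xs ++ y ∷ ys)          ≡⟨ cong (𝟙 (p x) +_) (count-insert p xs y ys) ⟩
  𝟙 (p x) + (𝟙 (p y) + count p (xs ++ ys))  ≡⟨ +-assoc (𝟙 (p x)) _ _ ⟨
  𝟙 (p x) + 𝟙 (p y) + count p (xs ++ ys)    ≡⟨ cong (_+ count p (xs ++ ys)) split ⟩
  k + 𝟙 (p z) + count p (xs ++ ys)          ≡⟨ +-assoc k _ _ ⟩
  k + count p (z ∷ xs ++ ys)                ∎
  where open ≡-Reasoning

count-filterᵇ : ∀ (p q : A → Bool) xs → count p (filterᵇ q xs) ≡ count (λ x → q x ∧ p x) xs
count-filterᵇ p q []       = refl
count-filterᵇ p q (x ∷ xs) with q x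
... | true  = cong (𝟙 (p x) +_) (count-filterᵇ p q xs)
... | false = count-filterᵇ p q xs

module _ {p q : A → Bool} where

  count-cong : ∀ xs → (∀ x → p x ≡ q x) → count p xs ≡ count q xs
  count-cong []       p≗q = refl
  count-cong (x ∷ xs) p≗q = cong₂ _+_ (cong 𝟙 (p≗q x)) (count-cong xs p≗q)

  count-mono : ∀ xs → (∀ x → 𝟙 (p x) ≤ 𝟙 (q x)) → count p xs ≤ count q xs
  count-mono []       p≤q = z≤n
  count-mono (x ∷ xs) p≤q = +-mono-≤ (p≤q x) (count-mono xs p≤q)

  count-mono-< : ∀ xs → (∀ x → 𝟙 (p x) ≤ 𝟙 (q x)) →
                 ∀ {y} → y ∈ xs → 𝟙 (p y) < 𝟙 (q y) → count p xs < count q xs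
  count-mono-< (x ∷ xs) p≤q (here refl) p<q = +-mono-<-≤ p<q (count-mono xs p≤q)
  count-mono-< (x ∷ xs) p≤q (there y∈) p<q = +-mono-≤-< (p≤q x) (count-mono-< xs p≤q y∈ p<q)

  count-split : ∀ {r : A → Bool} xs → (∀ x → 𝟙 (r x) ≡ 𝟙 (p x) + 𝟙 (q x)) →
                count r xs ≡ count p xs + count q xs
  count-split []       split = refl
  count-split (x ∷ xs) split = trans (cong₂ _+_ (split x) (count-split xs split))
                                     (interchange (𝟙 (p x)) (𝟙 (q x)) (count p xs) (count q xs))

count-none : ∀ {p : A → Bool} xs → All (λ x → p x ≡ false) xs → count p xs ≡ 0
count-none []       []             = refl
count-none (x ∷ xs) (px≡false ∷ all) = cong₂ _+_ (cong 𝟙 px≡false) (count-none xs all)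

count-filterᵇ-comm : ∀ (p q : A → Bool) xs → count p (filterᵇ q xs) ≡ count q (filterᵇ p xs)
count-filterᵇ-comm p q xs = begin
  count p (filterᵇ q xs)           ≡⟨ count-filterᵇ p q xs ⟩
  count (λ x → q x ∧ p x) xs       ≡⟨ count-cong xs (λ x → ∧-comm (q x) (p x)) ⟩
  count (λ x → p x ∧ q x) xs       ≡⟨ count-filterᵇ q p xs ⟨
  count q (filterᵇ p xs)           ∎
  where open ≡-Reasoning

count-map : ∀ (p : B → Bool) (f : A → B) xs → count p (map f xs) ≡ count (p ∘ f) xs
count-map p f []       = refl
count-map p f (x ∷ xs) = cong (𝟙 (p (f x)) +_) (count-map p f xs)

filterᵇ-map : ∀ (p : A → Bool) (f : B → A) xs → filterᵇ p (map f xs) ≡ map f (filterᵇ (p ∘ f) xs)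
filterᵇ-map p f []       = refl
filterᵇ-map p f (x ∷ xs) with p (f x)
... | true  = cong (f x ∷_) (filterᵇ-map p f xs)
... | false = filterᵇ-map p f xs

filterᵇ-cartesianProductʳ : ∀ (p : A → Bool) (xs : List B) (ys : List A) →
  filterᵇ (p ∘ proj₂) (cartesianProduct xs ys) ≡ cartesianProduct xs (filterᵇ p ys)
filterᵇ-cartesianProductʳ p []       ys = refl
filterᵇ-cartesianProductʳ p (x ∷ xs) ys = begin
  filterᵇ (p ∘ proj₂) (map (x ,_) ys ++ cartesianProduct xs ys)
      ≡⟨ filter-++ (T? ∘ p ∘ proj₂) (map (x ,_) ys) _ ⟩
  filterᵇ (p ∘ proj₂) (map (x ,_) ys) ++ filterᵇ (p ∘ proj₂) (cartesianProduct xs ys)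
      ≡⟨ cong₂ _++_ (filterᵇ-map (p ∘ proj₂) (x ,_) ys) (filterᵇ-cartesianProductʳ p xs ys) ⟩
  map (x ,_) (filterᵇ p ys) ++ cartesianProduct xs (filterᵇ p ys) ∎
  where open ≡-Reasoning

filterᵇ-const : ∀ b (xs : List A) → filterᵇ (λ _ → b) xs ≡ (if b then xs else [])
filterᵇ-const true  []       = refl
filterᵇ-const true  (x ∷ xs) = cong (x ∷_) (filterᵇ-const true xs)
filterᵇ-const false []       = refl
filterᵇ-const false (x ∷ xs) = filterᵇ-const false xs

filterᵇ-∷ : ∀ (p : A → Bool) x xs →
  filterᵇ p (x ∷ xs) ≡ (if p x then x ∷ filterᵇ p xs else filterᵇ p xs)
filterᵇ-∷ p x xs with p x
... | true  = refl
... | false = refl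

filterᵇ-cartesianProductˡ : ∀ (p : A → Bool) xs (ys : List B) →
  filterᵇ (p ∘ proj₁) (cartesianProduct xs ys) ≡ cartesianProduct (filterᵇ p xs) ys
filterᵇ-cartesianProductˡ p []       ys = refl
filterᵇ-cartesianProductˡ p (x ∷ xs) ys = begin
  filterᵇ (p ∘ proj₁) (map (x ,_) ys ++ cartesianProduct xs ys)
    ≡⟨ filter-++ (T? ∘ p ∘ proj₁) (map (x ,_) ys) _ ⟩
  filterᵇ (p ∘ proj₁) (map (x ,_) ys) ++ filterᵇ (p ∘ proj₁) (cartesianProduct xs ys)
    ≡⟨ cong₂ _++_ (filterᵇ-map (p ∘ proj₁) (x ,_) ys) (filterᵇ-cartesianProductˡ p xs ys) ⟩
  map (x ,_) (filterᵇ (λ _ → p x) ys) ++ cartesianProduct (filterᵇ p xs) ys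
    ≡⟨ cong (λ zs → map (x ,_) zs ++ _) (filterᵇ-const (p x) ys) ⟩
  map (x ,_) (if p x then ys else []) ++ cartesianProduct (filterᵇ p xs) ys
    ≡⟨ prepend (p x) ⟩
  cartesianProduct (if p x then x ∷ filterᵇ p xs else filterᵇ p xs) ys
    ≡⟨ cong (λ zs → cartesianProduct zs ys) (filterᵇ-∷ p x xs) ⟨
  cartesianProduct (filterᵇ p (x ∷ xs)) ys ∎
  where
  open ≡-Reasoning
  prepend : ∀ b → map (x ,_) (if b then ys else []) ++ cartesianProduct (filterᵇ p xs) ys
                  ≡ cartesianProduct (if b then x ∷ filterᵇ p xs else filterᵇ p xs) ys
  prepend true  = refl
  prepend false = refl

length-insert : ∀ (xs : List A) y ys → length (xs ++ y ∷ ys) ≡ suc (length (xs ++ ys))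
length-insert []       y ys = refl
length-insert (x ∷ xs) y ys = cong suc (length-insert xs y ys)

cartesianProduct-singletonˡ : ∀ (x : A) (ys : List B) → cartesianProduct [ x ] ys ≡ map (x ,_) ys
cartesianProduct-singletonˡ x ys = ++-identityʳ (map (x ,_) ys)

cartesianProduct-singletonʳ : ∀ (xs : List A) (y : B) → cartesianProduct xs [ y ] ≡ map (_, y) xs
cartesianProduct-singletonʳ []       y = refl
cartesianProduct-singletonʳ (x ∷ xs) y = cong ((x , y) ∷_) (cartesianProduct-singletonʳ xs y)

any-true : ∀ (p : A → Bool) {x xs} → x ∈ xs → p x ≡ true → any p xs ≡ true
any-true p {xs = y ∷ xs} (here refl) px≡t = cong (_∨ any p xs) px≡t
any-true p {xs = y ∷ xs} (there x∈) px≡t =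
  trans (cong (p y ∨_) (any-true p x∈ px≡t)) (∨-zeroʳ (p y))

any-false : ∀ (p : A → Bool) xs → (∀ {x} → x ∈ xs → p x ≡ false) → any p xs ≡ false
any-false p []       _    = refl
any-false p (x ∷ xs) none = cong₂ _∨_ (none (here refl)) (any-false p xs (none ∘ there))

∈-take⁻ : ∀ k {xs : List A} {x} → x ∈ take k xs → x ∈ xs
∈-take⁻ k {xs} x∈ = subst (_ ∈_) (take++drop≡id k xs) (∈-++⁺ˡ x∈)

∈-drop⁻ : ∀ k {xs : List A} {x} → x ∈ drop k xs → x ∈ xs
∈-drop⁻ k {xs} x∈ = subst (_ ∈_) (take++drop≡id k xs) (∈-++⁺ʳ (take k xs) x∈)

unique-head : ∀ {x} {xs : List A} → Unique (x ∷ xs) → x ∉ xs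
unique-head (x≢xs ∷ _) x∈xs = All.lookup x≢xs x∈xs refl

take-drop-disjoint : ∀ k {xs : List A} {x} → Unique xs → x ∈ take k xs → x ∉ drop k xs
take-drop-disjoint (suc k) {_ ∷ xs} unique       (here refl) x∈ = unique-head unique (∈-drop⁻ k x∈)
take-drop-disjoint (suc k) {_ ∷ xs} (_ ∷ unique) (there x∈)     = take-drop-disjoint k unique x∈

m+n≤o⇒n≤o∸m : ∀ m {n o} → m + n ≤ o → n ≤ o ∸ m
m+n≤o⇒n≤o∸m m {n} m+n≤o = subst (_≤ _) (m+n∸m≡n m n) (∸-monoˡ-≤ m m+n≤o)

half-≤ : ∀ {k m n} → 2 * k ≤ m + n → n ≤ suc m → k ≤ m
half-≤ {k} {m} {n} 2k≤m+n n≤1+m = s≤s⁻¹ (*-cancelˡ-< 2 k (suc m) 2k<2[1+m])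
  where
  open ≤-Reasoning
  2k<2[1+m] : 2 * k < 2 * suc m
  2k<2[1+m] = begin-strict
    2 * k                ≤⟨ 2k≤m+n ⟩
    m + n                ≤⟨ +-monoʳ-≤ m n≤1+m ⟩
    m + suc m            ≡⟨ +-suc m m ⟩
    suc (m + m)          <⟨ n<1+n _ ⟩
    suc (suc (m + m))    ≡⟨ cong (λ x → suc (suc (m + x))) (+-identityʳ m) ⟨
    2 + 2 * m            ≡⟨ *-suc 2 m ⟨
    2 * suc m            ∎

-- Balanced orientations of lists of pairs

Close : ℕ → ℕ → Set
Close m n = m ≤ suc n × n ≤ suc m

close-sym : ∀ {m n} → Close m n → Close n m
close-sym (m≤1+n , n≤1+m) = n≤1+m , m≤1+n

close-+ : ∀ k {m n} → Close m n → Close (k + m) (k + n)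
close-+ k {m} {n} (m≤1+n , n≤1+m) =
  subst (k + m ≤_) (+-suc k n) (+-monoʳ-≤ k m≤1+n) ,
  subst (k + n ≤_) (+-suc k m) (+-monoʳ-≤ k n≤1+m)

close-sucʳ : ∀ {m n} → n ≤ m → Close m n → Close m (suc n)
close-sucʳ n≤m (m≤1+n , _) = m≤n⇒m≤1+n m≤1+n , s≤s n≤m

close-sucˡ : ∀ {m n} → m ≤ n → Close m n → Close (suc m) n
close-sucˡ m≤n = close-sym ∘ close-sucʳ m≤n ∘ close-sym

SameEdge : A × A → A × A → Set
SameEdge e o = o ≡ e ⊎ o ≡ swap e

sameEdge-refl : ∀ (e : A × A) → SameEdge e e
sameEdge-refl e = inj₁ refl

sameEdge-swap : ∀ (e : A × A) → SameEdge e (swap e)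
sameEdge-swap e = inj₂ refl

sameEdge-sym : ∀ {e o : A × A} → SameEdge e o → SameEdge o e
sameEdge-sym (inj₁ refl) = inj₁ refl
sameEdge-sym (inj₂ refl) = inj₂ refl

sameEdge-trans : ∀ {e o p : A × A} → SameEdge e o → SameEdge o p → SameEdge e p
sameEdge-trans (inj₁ refl) (inj₁ refl) = inj₁ refl
sameEdge-trans (inj₁ refl) (inj₂ refl) = inj₂ refl
sameEdge-trans (inj₂ refl) (inj₁ refl) = inj₂ refl
sameEdge-trans (inj₂ refl) (inj₂ refl) = inj₁ refl

Reoriented : List (A × A) → List (A × A) → Set
Reoriented = Pointwise SameEdge

Simple : List (A × A) → Set
Simple = AllPairs (λ e e′ → ¬ SameEdge e e′)

reoriented-++⁻ : ∀ (E₁ : List (A × A)) {E₂ O} → Reoriented (E₁ ++ E₂) O →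
                 ∃[ O₁ ] ∃[ O₂ ] O ≡ O₁ ++ O₂ × Reoriented E₁ O₁ × Reoriented E₂ O₂
reoriented-++⁻ []       r       = [] , _ , refl , [] , r
reoriented-++⁻ (e ∷ E₁) (s ∷ r) with O₁ , O₂ , refl , r₁ , r₂ ← reoriented-++⁻ E₁ r =
  _ ∷ O₁ , O₂ , refl , s ∷ r₁ , r₂

∈-reoriented : ∀ {E O} {o : A × A} → Reoriented E O → o ∈ O → ∃[ e ] e ∈ E × SameEdge e o
∈-reoriented (s ∷ r) (here refl) = _ , here refl , s
∈-reoriented (s ∷ r) (there o∈) with e , e∈ , s′ ← ∈-reoriented r o∈ = e , there e∈ , s′

simple-reoriented : ∀ {E O : List (A × A)} → Reoriented E O → Simple E → Simple O
simple-reoriented []      []                = []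
simple-reoriented (s ∷ r) (distinct ∷ simple) =
  distinct-reoriented s r distinct ∷ simple-reoriented r simple
  where
  distinct-reoriented : ∀ {e o E O} → SameEdge e o → Reoriented E O →
                        All (λ e′ → ¬ SameEdge e e′) E → All (λ o′ → ¬ SameEdge o o′) O
  distinct-reoriented s []        []       = []
  distinct-reoriented s (s′ ∷ r) (d ∷ ds) =
    (λ o~o′ → d (sameEdge-trans s (sameEdge-trans o~o′ (sameEdge-sym s′))))
    ∷ distinct-reoriented s r ds

module Reorientation {A : Set} (_≟_ : DecidableEquality A) where

  outdeg indeg : A → List (A × A) → ℕ
  outdeg v = count (λ e → ⌊ proj₁ e ≟ v ⌋)
  indeg  v = count (λ e → ⌊ proj₂ e ≟ v ⌋)

  Balanced : List (A × A) → Set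
  Balanced O = ∀ v → Close (indeg v O) (outdeg v O)

  Incident : A → A × A → Set
  Incident v e = proj₁ e ≡ v ⊎ proj₂ e ≡ v

  incident⇒sameEdge : ∀ {v e} → Incident v e → ∃[ w ] SameEdge (v , w) e
  incident⇒sameEdge {e = _ , w} (inj₁ refl) = w , inj₁ refl
  incident⇒sameEdge {e = u , _} (inj₂ refl) = u , inj₂ refl

  incidences-sameEdge : ∀ v {e o} → SameEdge e o →
    𝟙 ⌊ proj₁ o ≟ v ⌋ + 𝟙 ⌊ proj₂ o ≟ v ⌋ ≡ 𝟙 ⌊ proj₁ e ≟ v ⌋ + 𝟙 ⌊ proj₂ e ≟ v ⌋
  incidences-sameEdge v (inj₁ refl) = refl
  incidences-sameEdge v {e} (inj₂ refl) = +-comm (𝟙 ⌊ proj₂ e ≟ v ⌋) (𝟙 ⌊ proj₁ e ≟ v ⌋)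

  reoriented-incidences : ∀ v {E O} → Reoriented E O →
                          outdeg v O + indeg v O ≡ outdeg v E + indeg v E
  reoriented-incidences v [] = refl
  reoriented-incidences v (_∷_ {x = e} {y = o} {xs = E} {ys = O} s r) = begin
    (𝟙 ⌊ proj₁ o ≟ v ⌋ + outdeg v O) + (𝟙 ⌊ proj₂ o ≟ v ⌋ + indeg v O)
      ≡⟨ interchange (𝟙 ⌊ proj₁ o ≟ v ⌋) _ _ _ ⟩
    (𝟙 ⌊ proj₁ o ≟ v ⌋ + 𝟙 ⌊ proj₂ o ≟ v ⌋) + (outdeg v O + indeg v O)
      ≡⟨ cong₂ _+_ (incidences-sameEdge v s) (reoriented-incidences v r) ⟩
    (𝟙 ⌊ proj₁ e ≟ v ⌋ + 𝟙 ⌊ proj₂ e ≟ v ⌋) + (outdeg v E + indeg v E)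
      ≡⟨ interchange (𝟙 ⌊ proj₁ e ≟ v ⌋) _ _ _ ⟨
    (𝟙 ⌊ proj₁ e ≟ v ⌋ + outdeg v E) + (𝟙 ⌊ proj₂ e ≟ v ⌋ + indeg v E) ∎
    where open ≡-Reasoning

  isolated : ∀ v {E O} → Reoriented E O → All (¬_ ∘ Incident v) E →
             outdeg v O ≡ 0 × indeg v O ≡ 0
  isolated v {E} {O} r not-incident = m+n≡0⇒m≡0 _ none , m+n≡0⇒n≡0 (outdeg v O) none
    where
    none : outdeg v O + indeg v O ≡ 0
    none = trans (reoriented-incidences v r) (cong₂ _+_
      (count-none E (All.map (λ ¬inc → ⌊⌋-false (¬inc ∘ inj₁)) not-incident))
      (count-none E (All.map (λ ¬inc → ⌊⌋-false (¬inc ∘ inj₂)) not-incident)))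

  balanced-loop : ∀ {a O} → Balanced O → Balanced ((a , a) ∷ O)
  balanced-loop {a} balanced v = close-+ (𝟙 ⌊ a ≟ v ⌋) (balanced v)

  balanced-pendant : ∀ {a b O} → a ≢ b → outdeg b O ≡ 0 → indeg b O ≡ 0 → Balanced O →
                     ∃[ o ] SameEdge (a , b) o × Balanced (o ∷ O)
  balanced-pendant {a} {b} {O} a≢b out-b in-b balanced
    with ≤-total (outdeg a O) (indeg a O)
  ... | inj₁ out≤in = (a , b) , sameEdge-refl _ , balanced′
    where
    balanced′ : Balanced ((a , b) ∷ O)
    balanced′ v with a ≟ v | b ≟ v
    ... | yes refl | yes refl = ⊥-elim (a≢b refl)
    ... | yes refl | no _     = close-sucʳ out≤in (balanced a)
    ... | no _     | yes refl = subst₂ Close (cong suc (sym in-b)) (sym out-b) (s≤s z≤n , z≤n)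
    ... | no _     | no _     = balanced v
  ... | inj₂ in≤out = (b , a) , sameEdge-swap _ , balanced′
    where
    balanced′ : Balanced ((b , a) ∷ O)
    balanced′ v with a ≟ v | b ≟ v
    ... | yes refl | yes refl = ⊥-elim (a≢b refl)
    ... | yes refl | no _     = close-sucˡ in≤out (balanced a)
    ... | no _     | yes refl = subst₂ Close (sym in-b) (cong suc (sym out-b)) (z≤n , s≤s z≤n)
    ... | no _     | no _     = balanced v

  -- Routing a–c through b adds one in- and one out-edge at b and changes nothing else.
  balanced-detour : ∀ {a b c f E₁ E₂ O} → SameEdge (b , c) f →
                    Reoriented ((a , c) ∷ E₁ ++ E₂) O → Balanced O →
                    ∃[ O′ ] Reoriented ((a , b) ∷ E₁ ++ f ∷ E₂) O′ × Balanced O′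
  balanced-detour {a} {b} {c} {E₁ = E₁} bc~f (s ∷ r) balanced
    with O₁ , O₂ , refl , r₁ , r₂ ← reoriented-++⁻ E₁ r | s
  ... | inj₁ refl =
    (a , b) ∷ O₁ ++ (b , c) ∷ O₂ ,
    sameEdge-refl _ ∷ ++⁺ r₁ (sameEdge-sym bc~f ∷ r₂) ,
    λ v → subst₂ Close
      (sym (count-detour (λ e → ⌊ proj₂ e ≟ v ⌋) (𝟙 ⌊ b ≟ v ⌋) (a , b) (b , c) (a , c) O₁ O₂
             refl))
      (sym (count-detour (λ e → ⌊ proj₁ e ≟ v ⌋) (𝟙 ⌊ b ≟ v ⌋) (a , b) (b , c) (a , c) O₁ O₂
             (+-comm (𝟙 ⌊ a ≟ v ⌋) (𝟙 ⌊ b ≟ v ⌋))))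
      (close-+ (𝟙 ⌊ b ≟ v ⌋) (balanced v))
  ... | inj₂ refl =
    (b , a) ∷ O₁ ++ (c , b) ∷ O₂ ,
    sameEdge-swap _ ∷ ++⁺ r₁ (sameEdge-trans (sameEdge-sym bc~f) (sameEdge-swap _) ∷ r₂) ,
    λ v → subst₂ Close
      (sym (count-detour (λ e → ⌊ proj₂ e ≟ v ⌋) (𝟙 ⌊ b ≟ v ⌋) (b , a) (c , b) (c , a) O₁ O₂
             (+-comm (𝟙 ⌊ a ≟ v ⌋) (𝟙 ⌊ b ≟ v ⌋))))
      (sym (count-detour (λ e → ⌊ proj₁ e ≟ v ⌋) (𝟙 ⌊ b ≟ v ⌋) (b , a) (c , b) (c , a) O₁ O₂
             refl))
      (close-+ (𝟙 ⌊ b ≟ v ⌋) (balanced v))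

  balanced-reorientation : ∀ E → ∃[ O ] Reoriented E O × Balanced O
  balanced-reorientation E = bounded (length E) E ≤-refl
    where
    bounded : ∀ N E → length E ≤ N → ∃[ O ] Reoriented E O × Balanced O
    bounded _ [] _ = [] , [] , λ v → z≤n , z≤n
    bounded (suc N) ((a , b) ∷ E) (s≤s |E|≤N) with a ≟ b
    ... | yes refl =
      let O , r , balanced = bounded N E |E|≤N
      in (a , a) ∷ O , sameEdge-refl _ ∷ r , balanced-loop {O = O} balanced
    ... | no a≢b with any? (λ e → (proj₁ e ≟ b) ⊎-dec (proj₂ e ≟ b)) E
    ...   | yes incident-b =
      let f , f∈E , b∈f = find incident-b
          E₁ , E₂ , E≡E₁fE₂ = ∈-∃++ f∈E
          c , bc~f = incident⇒sameEdge b∈f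
          |E′|≤N = subst (_≤ N) (trans (cong length E≡E₁fE₂) (length-insert E₁ f E₂)) |E|≤N
          O , r , balanced = bounded N ((a , c) ∷ E₁ ++ E₂) |E′|≤N
      in subst (λ E → ∃[ O ] Reoriented ((a , b) ∷ E) O × Balanced O) (sym E≡E₁fE₂)
               (balanced-detour bc~f r balanced)
    ...   | no ¬incident-b =
      let O , r , balanced = bounded N E |E|≤N
          out-b , in-b = isolated b r (¬Any⇒All¬ E ¬incident-b)
          o , ab~o , balanced′ = balanced-pendant {O = O} a≢b out-b in-b balanced
      in o ∷ O , ab~o ∷ r , balanced′

  filterᵇ-≟-∉ : ∀ {v xs} → v ∉ xs → filterᵇ (λ x → ⌊ x ≟ v ⌋) xs ≡ []
  filterᵇ-≟-∉ {v} {[]}     _   = refl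
  filterᵇ-≟-∉ {v} {x ∷ xs} v∉ with x ≟ v
  ... | yes refl = ⊥-elim (v∉ (here refl))
  ... | no _     = filterᵇ-≟-∉ (v∉ ∘ there)

  filterᵇ-≟-unique : ∀ {v xs} → Unique xs → v ∈ xs → filterᵇ (λ x → ⌊ x ≟ v ⌋) xs ≡ [ v ]
  filterᵇ-≟-unique {v} {x ∷ xs} (x∉xs ∷ _) (here refl) with x ≟ x
  ... | yes _  = cong (x ∷_) (filterᵇ-≟-∉ (λ x∈xs → All.lookup x∉xs x∈xs refl))
  ... | no x≢x = ⊥-elim (x≢x refl)
  filterᵇ-≟-unique {v} {x ∷ xs} (x∉xs ∷ unique) (there v∈xs) with x ≟ v
  ... | yes refl = ⊥-elim (All.lookup x∉xs v∈xs refl)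
  ... | no _     = filterᵇ-≟-unique unique v∈xs

  outdeg-filterᵇ-cartesianProduct : ∀ (p : A × A → Bool) {v xs} → Unique xs → v ∈ xs → ∀ ys →
    outdeg v (filterᵇ p (cartesianProduct xs ys)) ≡ count (λ w → p (v , w)) ys
  outdeg-filterᵇ-cartesianProduct p {v} {xs} unique v∈xs ys = begin
    count (λ e → ⌊ proj₁ e ≟ v ⌋) (filterᵇ p (cartesianProduct xs ys))
      ≡⟨ count-filterᵇ-comm _ p (cartesianProduct xs ys) ⟩
    count p (filterᵇ (λ e → ⌊ proj₁ e ≟ v ⌋) (cartesianProduct xs ys))
      ≡⟨ cong (count p) (filterᵇ-cartesianProductˡ (λ u → ⌊ u ≟ v ⌋) xs ys) ⟩
    count p (cartesianProduct (filterᵇ (λ u → ⌊ u ≟ v ⌋) xs) ys)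
      ≡⟨ cong (λ us → count p (cartesianProduct us ys)) (filterᵇ-≟-unique unique v∈xs) ⟩
    count p (cartesianProduct [ v ] ys)
      ≡⟨ cong (count p) (cartesianProduct-singletonˡ v ys) ⟩
    count p (map (v ,_) ys)
      ≡⟨ count-map p (v ,_) ys ⟩
    count (λ w → p (v , w)) ys ∎
    where open ≡-Reasoning

  indeg-filterᵇ-cartesianProduct : ∀ (p : A × A → Bool) xs {v ys} → Unique ys → v ∈ ys →
    indeg v (filterᵇ p (cartesianProduct xs ys)) ≡ count (λ u → p (u , v)) xs
  indeg-filterᵇ-cartesianProduct p xs {v} {ys} unique v∈ys = begin
    count (λ e → ⌊ proj₂ e ≟ v ⌋) (filterᵇ p (cartesianProduct xs ys))
      ≡⟨ count-filterᵇ-comm _ p (cartesianProduct xs ys) ⟩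
    count p (filterᵇ (λ e → ⌊ proj₂ e ≟ v ⌋) (cartesianProduct xs ys))
      ≡⟨ cong (count p) (filterᵇ-cartesianProductʳ (λ u → ⌊ u ≟ v ⌋) xs ys) ⟩
    count p (cartesianProduct xs (filterᵇ (λ u → ⌊ u ≟ v ⌋) ys))
      ≡⟨ cong (λ us → count p (cartesianProduct xs us)) (filterᵇ-≟-unique unique v∈ys) ⟩
    count p (cartesianProduct xs [ v ])
      ≡⟨ cong (count p) (cartesianProduct-singletonʳ xs v) ⟩
    count p (map (_, v) xs)
      ≡⟨ count-map p (_, v) xs ⟩
    count (λ u → p (u , v)) xs ∎
    where open ≡-Reasoning

  outNbrs : List (A × A) → A → List A
  outNbrs O v = map proj₂ (filterᵇ (λ e → ⌊ proj₁ e ≟ v ⌋) O)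

  length-outNbrs : ∀ O v → length (outNbrs O v) ≡ outdeg v O
  length-outNbrs O v = trans (length-map proj₂ (filterᵇ _ O)) (length-filterᵇ _ O)

  ∈-outNbrs : ∀ {O v w} → w ∈ outNbrs O v → (v , w) ∈ O
  ∈-outNbrs {(x , y) ∷ O} {v} w∈ with x ≟ v | w∈
  ... | yes refl | here refl = here refl
  ... | yes refl | there w∈′ = there (∈-outNbrs w∈′)
  ... | no _     | w∈′       = there (∈-outNbrs w∈′)

  unique-outNbrs : ∀ {O} → Simple O → ∀ v → Unique (outNbrs O v)
  unique-outNbrs {[]}          []                  v = []
  unique-outNbrs {(x , y) ∷ O} (distinct ∷ simple) v with x ≟ v
  ... | yes refl =
    All.tabulate (λ w∈ y≡w → All.lookup distinct (∈-outNbrs w∈) (inj₁ (cong (x ,_) (sym y≡w))))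
    ∷ unique-outNbrs simple v
  ... | no _     = unique-outNbrs simple v

  simple-sameEdge : ∀ {O : List (A × A)} {e e′} → Simple O → e ∈ O → e′ ∈ O → SameEdge e e′ → e ≡ e′
  simple-sameEdge _              (here refl) (here refl) _ = refl
  simple-sameEdge (distinct ∷ _) (here refl) (there e′∈) s = ⊥-elim (All.lookup distinct e′∈ s)
  simple-sameEdge (distinct ∷ _) (there e∈)  (here refl) s =
    ⊥-elim (All.lookup distinct e∈ (sameEdge-sym s))
  simple-sameEdge (_ ∷ simple)   (there e∈)  (there e′∈) s = simple-sameEdge simple e∈ e′∈ s

  outNbrs-antisym : ∀ {O v w} → Simple O → w ∈ outNbrs O v → v ∈ outNbrs O w → v ≡ w
  outNbrs-antisym simple w∈ v∈ =
    cong proj₁ (simple-sameEdge simple (∈-outNbrs w∈) (∈-outNbrs v∈) (sameEdge-swap _))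

ascending : ∀ {n} → Mat n → Edge n → Bool
ascending A (x , y) = (toℕ x <ᵇ toℕ y) ∧ A x y

edges : ∀ {n} → Mat n → List (Edge n)
edges {n} A = filterᵇ (ascending A) (cartesianProduct (allFin n) (allFin n))

module _ {n : ℕ} where
  open Reorientation (_≟_ {n})

  deg-count : ∀ (A : Mat n) v → deg A v ≡ count (A v) (allFin n)
  deg-count A v = length-filterᵇ (A v) (allFin n)

  adjacent-ascending : ∀ (G : Graph n) v w →
    𝟙 (adj G v w) ≡ 𝟙 (ascending (adj G) (v , w)) + 𝟙 (ascending (adj G) (w , v))
  adjacent-ascending G v w
    rewrite adj-sym G w v
    with toℕ v <ᵇ toℕ w | <ᵇ-reflects-< (toℕ v) (toℕ w)
       | toℕ w <ᵇ toℕ v | <ᵇ-reflects-< (toℕ w) (toℕ v)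
  ... | true  | ofʸ v<w | true  | ofʸ w<v = ⊥-elim (<-asym v<w w<v)
  ... | true  | _       | false | _       = sym (+-identityʳ _)
  ... | false | _       | true  | _       = refl
  ... | false | ofⁿ v≮w | false | ofⁿ w≮v = cong 𝟙 (trans (cong (adj G v) (sym v≡w)) (irrefl G v))
    where
    v≡w : v ≡ w
    v≡w = toℕ-injective (≤-antisym (≮⇒≥ w≮v) (≮⇒≥ v≮w))

  incidences-edges : ∀ (G : Graph n) v →
                     outdeg v (edges (adj G)) + indeg v (edges (adj G)) ≡ deg (adj G) v
  incidences-edges G v = begin
    outdeg v (edges (adj G)) + indeg v (edges (adj G))
      ≡⟨ cong₂ _+_ (outdeg-filterᵇ-cartesianProduct _ (Unique.allFin⁺ n) (∈-allFin v) (allFin n))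
                   (indeg-filterᵇ-cartesianProduct _ (allFin n) (Unique.allFin⁺ n) (∈-allFin v)) ⟩
    count (λ w → ascending (adj G) (v , w)) (allFin n) +
    count (λ u → ascending (adj G) (u , v)) (allFin n)
      ≡⟨ count-split (allFin n) (adjacent-ascending G v) ⟨
    count (adj G v) (allFin n)
      ≡⟨ deg-count (adj G) v ⟨
    deg (adj G) v ∎
    where open ≡-Reasoning

  ∈-edges : ∀ {A : Mat n} {e} → e ∈ edges A →
            toℕ (proj₁ e) < toℕ (proj₂ e) × A (proj₁ e) (proj₂ e) ≡ true
  ∈-edges {A} e∈
    with _ , asc ← ∈-filter⁻ (T? ∘ ascending A) {xs = cartesianProduct (allFin n) (allFin n)} e∈
    with ordered , adjacent ← Equivalence.to T-∧ asc =
    <ᵇ⇒< _ _ ordered , Equivalence.to T-≡ adjacent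

  simple-ascending : ∀ {E : List (Edge n)} → Unique E →
                     All (λ e → toℕ (proj₁ e) < toℕ (proj₂ e)) E → Simple E
  simple-ascending []                  []               = []
  simple-ascending (e∉E ∷ unique) (e< ∷ ascending) =
    All.zipWith distinct (e∉E , ascending) ∷ simple-ascending unique ascending
    where
    distinct : ∀ {e′} → _ ≢ e′ × toℕ (proj₁ e′) < toℕ (proj₂ e′) → ¬ SameEdge _ e′
    distinct (e≢e′ , _)   (inj₁ e′≡e) = e≢e′ (sym e′≡e)
    distinct (_    , e′<) (inj₂ refl) = <-asym e< e′<

  simple-edges : ∀ (A : Mat n) → Simple (edges A)
  simple-edges A = simple-ascending
    (Unique.filter⁺ (T? ∘ ascending A)
      (Unique.cartesianProduct⁺ (Unique.allFin⁺ n) (Unique.allFin⁺ n)))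
    (All.tabulate (proj₁ ∘ ∈-edges))

  Symmetric : Mat n → Set
  Symmetric U = ∀ x y → U x y ≡ U y x

  symmetric-sameEdge : ∀ {U} → Symmetric U → ∀ {e o : Edge n} → SameEdge e o →
                       U (proj₁ e) (proj₂ e) ≡ U (proj₁ o) (proj₂ o)
  symmetric-sameEdge U-sym (inj₁ refl) = refl
  symmetric-sameEdge U-sym (inj₂ refl) = U-sym _ _

  adjacent⇒≢ : ∀ (G : Graph n) {v w} → adj G v w ≡ true → v ≢ w
  adjacent⇒≢ G {v} adjacent refl = case trans (sym adjacent) (irrefl G v) of λ ()

  record BalancedOrientation (G : Graph n) : Set where
    field
      out          : Fin n → List (Fin n)
      unique-out   : ∀ v → Unique (out v)
      out-adjacent : ∀ {v w} → w ∈ out v → adj G v w ≡ true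
      out-antisym  : ∀ {v w} → w ∈ out v → v ∉ out w
      out-half     : ∀ v {k} → 2 * k ≤ deg (adj G) v → k ≤ length (out v)

  balancedOrientation : (G : Graph n) → BalancedOrientation G
  balancedOrientation G with O , r , balanced ← balanced-reorientation (edges (adj G)) = record
    { out          = outNbrs O
    ; unique-out   = unique-outNbrs simple
    ; out-adjacent = adjacent ∘ ∈-outNbrs
    ; out-antisym  = λ w∈ v∈ → adjacent⇒≢ G (adjacent (∈-outNbrs w∈)) (outNbrs-antisym simple w∈ v∈)
    ; out-half     = half
    }
    where
    simple : Simple O
    simple = simple-reoriented r (simple-edges (adj G))

    adjacent : ∀ {v w} → (v , w) ∈ O → adj G v w ≡ true
    adjacent o∈ with e , e∈ , e~o ← ∈-reoriented r o∈ =
      trans (sym (symmetric-sameEdge (adj-sym G) e~o)) (proj₂ (∈-edges e∈))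

    half : ∀ v {k} → 2 * k ≤ deg (adj G) v → k ≤ length (outNbrs O v)
    half v {k} 2k≤deg =
      subst (k ≤_) (sym (length-outNbrs O v)) (half-≤ 2k≤out+in (proj₁ (balanced v)))
      where
      2k≤out+in : 2 * k ≤ outdeg v O + indeg v O
      2k≤out+in = subst (2 * k ≤_)
        (sym (trans (reoriented-incidences v r) (incidences-edges G v))) 2k≤deg

  hits⇒sameEdge : ∀ {e : Edge n} {x y} → hits e x y ≡ true → SameEdge e (x , y)
  hits⇒sameEdge {a , b} {x} {y} hit with a ≟ x | b ≟ y | a ≟ y | b ≟ x
  ... | yes refl | yes refl | _        | _        = inj₁ refl
  ... | _        | _        | yes refl | yes refl = inj₂ refl
  ... | no _     | _        | no _     | _        = case hit of λ ()
  ... | yes _    | no _     | no _     | _        = case hit of λ ()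
  ... | yes _    | no _     | yes _    | no _     = case hit of λ ()
  ... | no _     | _        | yes _    | no _     = case hit of λ ()

  sameEdge⇒hits : ∀ {e : Edge n} {x y} → SameEdge e (x , y) → hits e x y ≡ true
  sameEdge⇒hits {a , b} (inj₁ refl) =
    cong₂ (λ s t → (s ∧ t) ∨ (⌊ a ≟ b ⌋ ∧ ⌊ b ≟ a ⌋))
      (⌊⌋-true {P? = a ≟ a} refl) (⌊⌋-true {P? = b ≟ b} refl)
  sameEdge⇒hits {a , b} (inj₂ refl) = trans
    (cong₂ (λ s t → (⌊ a ≟ b ⌋ ∧ ⌊ b ≟ a ⌋) ∨ (s ∧ t))
      (⌊⌋-true {P? = a ≟ a} refl) (⌊⌋-true {P? = b ≟ b} refl))
    (∨-zeroʳ _)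

  edge : Fin n → Fin n → Edge n
  edge v w = if toℕ v <ᵇ toℕ w then (v , w) else (w , v)

  edge-sameEdge : ∀ v w → SameEdge (v , w) (edge v w)
  edge-sameEdge v w with toℕ v <ᵇ toℕ w
  ... | true  = sameEdge-refl _
  ... | false = sameEdge-swap _

  edge-ascending : ∀ {v w} → v ≢ w → toℕ (proj₁ (edge v w)) < toℕ (proj₂ (edge v w))
  edge-ascending {v} {w} v≢w with toℕ v <ᵇ toℕ w | <ᵇ-reflects-< (toℕ v) (toℕ w)
  ... | true  | ofʸ v<w = v<w
  ... | false | ofⁿ v≮w = ≤∧≢⇒< (≮⇒≥ v≮w) (λ w≡v → v≢w (toℕ-injective (sym w≡v)))

  edge-injectiveʳ : ∀ {v w w′} → edge v w ≡ edge v w′ → w ≡ w′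
  edge-injectiveʳ {v} {w} {w′} eq
    with sameEdge-trans (edge-sameEdge v w)
           (subst (λ e → SameEdge e (v , w′)) (sym eq) (sameEdge-sym (edge-sameEdge v w′)))
  ... | inj₁ refl = refl
  ... | inj₂ refl = refl

  removeAll-symmetric : ∀ O {U} → Symmetric U → Symmetric (removeAll O U)
  removeAll-symmetric O U-sym x y =
    cong₂ (λ u h → u ∧ not h) (U-sym x y) (cong or (map-cong (λ e → hits-sym e) O))
    where
    hits-sym : ∀ (e : Edge n) → hits e x y ≡ hits e y x
    hits-sym (a , b) = ∨-comm (⌊ a ≟ x ⌋ ∧ ⌊ b ≟ y ⌋) (⌊ a ≟ y ⌋ ∧ ⌊ b ≟ x ⌋)

  removeAll-offered : ∀ {O : List (Edge n)} {U e x y} → e ∈ O → hits e x y ≡ true →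
                      removeAll O U x y ≡ false
  removeAll-offered {U = U} {x = x} {y} e∈O hit =
    trans (cong (λ h → U x y ∧ not h) (any-true (λ e → hits e x y) e∈O hit)) (∧-zeroʳ (U x y))

  removeAll-unoffered : ∀ {O U x y} → U x y ≡ true → (∀ {e} → e ∈ O → ¬ SameEdge e (x , y)) →
                        removeAll O U x y ≡ true
  removeAll-unoffered {O} {x = x} {y} Uxy unoffered = cong₂ (λ u h → u ∧ not h) Uxy
    (any-false (λ e → hits e x y) O (λ e∈O → ¬-not (unoffered e∈O ∘ hits⇒sameEdge)))

  addEdge-removeAll-disjoint : ∀ {O U C e} → e ∈ O → (∀ {x y} → C x y ≡ true → U x y ≡ false) →
                        ∀ {x y} → addEdge e C x y ≡ true → removeAll O U x y ≡ false
  addEdge-removeAll-disjoint {O} {U} {C} {e} e∈O disjoint {x} {y} claimed with C x y in Cxy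
  ... | true  = cong (λ u → u ∧ not (any (λ e → hits e x y) O)) (disjoint Cxy)
  ... | false = removeAll-offered {U = U} e∈O claimed

  deg-addEdge-mono : ∀ e (C : Mat n) v → deg C v ≤ deg (addEdge e C) v
  deg-addEdge-mono e C v = subst₂ _≤_ (sym (deg-count C v)) (sym (deg-count (addEdge e C) v))
    (count-mono (allFin n) (λ w → 𝟙-mono-∨ (C v w) (hits e v w)))

  deg-addEdge-< : ∀ {e C v w} → C v w ≡ false → hits e v w ≡ true → deg C v < deg (addEdge e C) v
  deg-addEdge-< {e} {C} {v} {w} Cvw hit =
    subst₂ _<_ (sym (deg-count C v)) (sym (deg-count (addEdge e C) v))
      (count-mono-< (allFin n) (λ w → 𝟙-mono-∨ (C v w) (hits e v w)) (∈-allFin w)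
        (subst₂ (λ c h → 𝟙 c < 𝟙 (c ∨ h)) (sym Cvw) (sym hit) (s≤s z≤n)))

  -- Waiter's strategy

  module Strategy (G : Graph n) (q γ : ℕ) (B : BalancedOrientation G)
                  (out-long : ∀ v → suc q * γ ≤ length (BalancedOrientation.out B v)) where
    open BalancedOrientation B

    Goal : Mat n → Set
    Goal C = MinDegAtLeast C γ

    record Invariant (pending : List (Fin n)) (U C : Mat n) : Set where
      field
        unclaimed-symmetric : Symmetric U
        claimed-unavailable : ∀ {x y} → C x y ≡ true → U x y ≡ false
        pending-unique      : Unique pending
        pending-or-done     : ∀ v → v ∈ pending ⊎ γ ≤ deg C v

    OutAvailable : List (Fin n) → Mat n → Set
    OutAvailable pending U = ∀ {u w} → u ∈ pending → w ∈ out u → U u w ≡ true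

    record Progress (v : Fin n) (r : ℕ) (U C : Mat n) : Set where
      field
        remaining           : List (Fin n)
        remaining⊆out       : ∀ {w} → w ∈ remaining → w ∈ out v
        remaining-unique    : Unique remaining
        remaining-available : ∀ {w} → w ∈ remaining → U v w ≡ true
        remaining-long      : suc q * r ≤ length remaining
        deg-progress        : γ ≤ deg C v + r

    offer : ∀ {v r U C} → Progress v r U C → List (Edge n)
    offer {v} progress = map (edge v) (take (suc q) (Progress.remaining progress))

    offered-sameEdge : ∀ {v ws e o} → e ∈ map (edge v) ws → SameEdge e o →
                       ∃[ w ] w ∈ ws × SameEdge (v , w) o
    offered-sameEdge {v} e∈ e~o with w , w∈ , refl ← ∈-map⁻ (edge v) e∈ =
      w , w∈ , sameEdge-trans (edge-sameEdge v _) e~o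

    invariant-step : ∀ {pending U C O e} → e ∈ O → Invariant pending U C →
                     Invariant pending (removeAll O U) (addEdge e C)
    invariant-step {U = U} {C} {O} {e} e∈O inv = record
      { unclaimed-symmetric = removeAll-symmetric O unclaimed-symmetric
      ; claimed-unavailable = addEdge-removeAll-disjoint {U = U} {C} e∈O claimed-unavailable
      ; pending-unique      = pending-unique
      ; pending-or-done     = λ u →
          map₂ (λ γ≤deg → ≤-trans γ≤deg (deg-addEdge-mono e C u)) (pending-or-done u)
      }
      where open Invariant inv

    valid-offer : ∀ {v r U C} → Symmetric U → (progress : Progress v (suc r) U C) →
                  ValidOffer q U (offer progress)
    valid-offer {v} {r} {U} U-sym progress =
      trans (length-map _ ws) (trans (length-take (suc q) remaining) (m≤n⇒m⊓n≡m 1+q≤length)) ,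
      Unique.map⁺ edge-injectiveʳ (Unique.take⁺ (suc q) remaining-unique) ,
      All.tabulate ascending-available
      where
      open Progress progress
      ws = take (suc q) remaining
      1+q≤length : suc q ≤ length remaining
      1+q≤length = ≤-trans (m≤m*n (suc q) (suc r)) remaining-long
      ascending-available : ∀ {e} → e ∈ map (edge v) ws →
                            toℕ (proj₁ e) < toℕ (proj₂ e) × U (proj₁ e) (proj₂ e) ≡ true
      ascending-available e∈ with w , w∈ws , refl ← ∈-map⁻ (edge v) e∈ =
        let w∈ = ∈-take⁻ (suc q) w∈ws
        in edge-ascending (adjacent⇒≢ G (out-adjacent (remaining⊆out w∈))) ,
           trans (sym (symmetric-sameEdge U-sym (edge-sameEdge v w)))
                 (remaining-available w∈)

    available-step : ∀ {v vs r U C} → Invariant (v ∷ vs) U C → OutAvailable vs U →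
                     (progress : Progress v r U C) → OutAvailable vs (removeAll (offer progress) U)
    available-step {v} {U = U} inv available progress {u} {w′} u∈vs w′∈out =
      removeAll-unoffered {U = U} (available u∈vs w′∈out) unoffered
      where
      unoffered : ∀ {e} → e ∈ offer progress → ¬ SameEdge e (u , w′)
      unoffered e∈ e~uw′ with offered-sameEdge e∈ e~uw′
      ... | _ , _   , inj₁ refl = unique-head (Invariant.pending-unique inv) u∈vs
      ... | w , w∈ , inj₂ refl =
        out-antisym (Progress.remaining⊆out progress (∈-take⁻ (suc q) w∈)) w′∈out

    progress-step : ∀ {pending v r U C w} → Invariant pending U C →
                    (progress : Progress v (suc r) U C) →
                    w ∈ take (suc q) (Progress.remaining progress) →
                    Progress v r (removeAll (offer progress) U) (addEdge (edge v w) C)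
    progress-step {v = v} {r} {U} {C} {w} inv progress w∈ws = record
      { remaining           = drop (suc q) remaining
      ; remaining⊆out       = remaining⊆out ∘ ∈-drop⁻ (suc q)
      ; remaining-unique    = Unique.drop⁺ (suc q) remaining-unique
      ; remaining-available = λ x∈ →
          removeAll-unoffered {U = U} (remaining-available (∈-drop⁻ (suc q) x∈)) (unoffered x∈)
      ; remaining-long      = subst (suc q * r ≤_) (sym (length-drop (suc q) remaining))
                                (m+n≤o⇒n≤o∸m (suc q) long)
      ; deg-progress        = ≤-trans (≤-trans deg-progress (≤-reflexive (+-suc (deg C v) r)))
                                      (+-monoˡ-≤ r deg-grows)
      }
      where
      open Progress progress
      open Invariant inv using (claimed-unavailable)
      long : suc q + suc q * r ≤ length remaining
      long = subst (_≤ length remaining) (*-suc (suc q) r) remaining-long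
      unoffered : ∀ {x} → x ∈ drop (suc q) remaining →
                  ∀ {e} → e ∈ offer progress → ¬ SameEdge e (v , x)
      unoffered x∈ e∈ e~vx with offered-sameEdge e∈ e~vx
      ... | _ , w∈ , inj₁ refl = take-drop-disjoint (suc q) remaining-unique w∈ x∈
      ... | _ , _  , inj₂ refl = adjacent⇒≢ G (out-adjacent (remaining⊆out (∈-drop⁻ (suc q) x∈))) refl
      w∈remaining = ∈-take⁻ (suc q) w∈ws
      Cvw≡false : C v w ≡ false
      Cvw≡false with C v w in Cvw
      ... | false = refl
      ... | true  = case trans (sym (claimed-unavailable Cvw)) (remaining-available w∈remaining) of λ ()
      deg-grows : suc (deg C v) ≤ deg (addEdge (edge v w) C) v
      deg-grows =
        deg-addEdge-< {edge v w} {C} Cvw≡false (sameEdge⇒hits (sameEdge-sym (edge-sameEdge v w)))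

    start : ∀ {v vs U C} → OutAvailable (v ∷ vs) U → Progress v γ U C
    start {v} {C = C} available = record
      { remaining           = out v
      ; remaining⊆out       = λ w∈ → w∈
      ; remaining-unique    = unique-out v
      ; remaining-available = available (here refl)
      ; remaining-long      = out-long v
      ; deg-progress        = m≤n+m γ (deg C v)
      }

    finish : ∀ {v vs U C} → Invariant (v ∷ vs) U C → Progress v 0 U C → Invariant vs U C
    finish {v} {vs} {C = C} inv progress = record
      { unclaimed-symmetric = unclaimed-symmetric
      ; claimed-unavailable = claimed-unavailable
      ; pending-unique      = tail pending-unique
      ; pending-or-done     = pending-or-done′
      }
      where
      open Invariant inv
      tail : Unique (v ∷ vs) → Unique vs
      tail (_ ∷ unique) = unique
      pending-or-done′ : ∀ u → u ∈ vs ⊎ γ ≤ deg C u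
      pending-or-done′ u with pending-or-done u
      ... | inj₁ (here refl) = inj₂ (subst (γ ≤_) (+-identityʳ _) (Progress.deg-progress progress))
      ... | inj₁ (there u∈)  = inj₁ u∈
      ... | inj₂ γ≤deg       = inj₂ γ≤deg

    mutual
      serve-all : ∀ pending {U C b} → Invariant pending U C → OutAvailable pending U →
                  suc q * γ * length pending ≤ b → WaiterForces q Goal U C b
      serve-all []       inv _         _      =
        done λ v → [ (λ ()) , id ]′ (Invariant.pending-or-done inv v)
      serve-all (v ∷ vs) {b = b} inv available budget =
        serve v vs γ inv (available ∘ there) (start available)
          (subst (_≤ b) (*-suc (suc q * γ) (length vs)) budget)

      serve : ∀ v vs r {U C b} → Invariant (v ∷ vs) U C → OutAvailable vs U → Progress v r U C →
              suc q * r + suc q * γ * length vs ≤ b → WaiterForces q Goal U C b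
      serve v vs zero {b = b} inv available progress budget =
        serve-all vs (finish inv progress) available
          (subst (λ k → k + suc q * γ * length vs ≤ b) (*-zeroʳ (suc q)) budget)
      serve v vs (suc r) {U} {C} {b} inv available progress budget =
        round (offer progress) (valid-offer (Invariant.unclaimed-symmetric inv) progress)
          (m+n≤o⇒m≤o (suc q) budget′) next
        where
        budget′ : suc q + (suc q * r + suc q * γ * length vs) ≤ b
        budget′ = subst (_≤ b)
          (trans (cong (_+ suc q * γ * length vs) (*-suc (suc q) r)) (+-assoc (suc q) (suc q * r) _))
          budget
        next : ∀ e → e ∈ offer progress →
               WaiterForces q Goal (removeAll (offer progress) U) (addEdge e C) (b ∸ suc q)
        next e e∈ with w , w∈ws , refl ← ∈-map⁻ (edge v) e∈ =
          serve v vs r (invariant-step e∈ inv) (available-step inv available progress)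
            (progress-step inv progress w∈ws) (m+n≤o⇒n≤o∸m (suc q) budget′)

lemma3p4 : ∀ (n : ℕ) (G : Graph n) (δ q γ : ℕ) → IsMinDegree G δ →
    1 ≤ q → 1 ≤ γ → γ ≤ δ / (2 * suc q) →
    WaiterForces q (λ C → MinDegAtLeast C γ) (adj G) emptyMat (suc q * γ * n)
lemma3p4 n G δ q γ (δ≤deg , _) _ _ γ≤δ/2[1+q] =
  serve-all (allFin n) initial (λ _ → out-adjacent)
    (subst (λ m → suc q * γ * m ≤ suc q * γ * n) (sym (length-tabulate id)) ≤-refl)
  where
  open BalancedOrientation (balancedOrientation G)

  2[1+q]γ≤δ : 2 * (suc q * γ) ≤ δ
  2[1+q]γ≤δ = begin
    2 * (suc q * γ)          ≡⟨ *-assoc 2 (suc q) γ ⟨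
    2 * suc q * γ            ≡⟨ *-comm (2 * suc q) γ ⟩
    γ * (2 * suc q)          ≤⟨ *-monoˡ-≤ (2 * suc q) γ≤δ/2[1+q] ⟩
    δ / (2 * suc q) * (2 * suc q) ≤⟨ m/n*n≤m δ (2 * suc q) ⟩
    δ                        ∎
    where open ≤-Reasoning

  open Strategy G q γ (balancedOrientation G) (λ v → out-half v (≤-trans 2[1+q]γ≤δ (δ≤deg v)))

  initial : Invariant (allFin n) (adj G) emptyMat
  initial = record
    { unclaimed-symmetric = adj-sym G
    ; claimed-unavailable = λ ()
    ; pending-unique      = Unique.allFin⁺ n
    ; pending-or-done     = inj₁ ∘ ∈-allFin
    }
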